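{- Let $d\ge0$, $\mathbb{F}$ a field, $V$ an $\mathbb{F}$-vector space of dimension $d+1$, $T\in{\rm Mat}_{d+1}(\mathbb{F})$ very good upper triangular, $\{u_i\}_{i=0}^d$ a basis of $V$, $v_j=\sum_iT_{ij}u_i$, and $B$ the Billiard Array $B_{(r,s,t)}=U_{d-r}\cap U'_{d-s}\cap U''_{d-t}$ where $U_i=\mathbb{F}u_0+\cdots+\mathbb{F}u_i$, $U'_i=\mathbb{F}u_d+\cdots+\mathbb{F}u_{d-i}$, $U''_i=\mathbb{F}v_d+\cdots+\mathbb{F}v_{d-i}$. Let $\mathcal{B}$ be the unique standard Concrete Billiard Array on $V$ corresponding to $B$ with $\mathcal{B}_{(d-i,0,i)}=v_i$ for $0\le i\le d$. For $\lambda\in\Delta_d$ write $\mathcal{B}_\lambda=\sum_{i=0}^dc_i(\lambda)v_i$. Then for every $\lambda=(r,s,t)\in\Delta_d$ we have $c_t(\lambda)=1$, and if $s>0$ then $$(c_{t+1}(\lambda),c_{t+2}(\lambda),\dots,c_{d-r}(\lambda))^t=-(T[t+1,d-r])^{ -1}(T_{0t},T_{1t},\dots,T_{s-1,t})^t.$$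
   Context: Matrices are indexed by $0,\dots,d$; $T[i,j]$ is the submatrix with rows $0,\dots,j-i$ and columns $i,\dots,j$; $T$ is very good if every $T[i,j]$ ($0\le i\le j\le d$) is invertible. $\Delta_d=\{(r,s,t)\in\mathbb{N}^3:r+s+t=d\}$. A line is a set of elements of $\Delta_d$ with a fixed $\eta$-coordinate ($\eta\in\{1,2,3\}$); a black 3-clique is $\{(a+1,b,c),(a,b+1,c),(a,b,c+1)\}$ with $(a,b,c)\in\Delta_{d-1}$. A Billiard Array on $V$ is a map $\lambda\mapsto B_\lambda$ from $\Delta_d$ to 1-dimensional subspaces of $V$ with direct sums along lines and non-direct sums over black 3-cliques (the $B$ above is one). A Concrete Billiard Array is a map $\lambda\mapsto\mathcal{B}_\lambda\in V$ such that the vectors on each line are linearly independent and the vectors on each black 3-clique are linearly dependent; it corresponds to $B$ if $\mathcal{B}_\lambda$ spans $B_\lambda$ for all $\lambda$. It is standard if for every $(a,b,c)\in\Delta_{d-1}$, $\mathcal{B}_{(a+1,b,c)}-\mathcal{B}_{(a,b+1,c)}\in\mathbb{F}\mathcal{B}_{(a,b,c+1)}$. (A unique such standard $\mathcal{B}$ with the stated values exists.) -}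

module Defs where

open import Level using (Level; _⊔_) renaming (suc to lsuc)
open import Data.Nat using (ℕ; zero; suc; _+_; _∸_; _≤_; _<_; _≡ᵇ_)
open import Data.Bool using (if_then_else_)
open import Data.Product using (Σ; ∃; _×_; _,_)
open import Relation.Nullary using (¬_)
open import Relation.Binary.PropositionalEquality using (_≡_)
open import Algebra.Bundles using (CommutativeRing)
open import Algebra.Module.Bundles using (Module)

record Field (c ℓ : Level) : Set (lsuc (c ⊔ ℓ)) where
  field
    commutativeRing : CommutativeRing c ℓ
  open CommutativeRing commutativeRing public
  field
    0≉1     : ¬ (0# ≈ 1#)
    inverse : ∀ x → ¬ (x ≈ 0#) → ∃ λ y → x * y ≈ 1#

-- Families of scalars/vectors/matrix entries are indexed by ℕ; only the indices
-- in the relevant finite ranges are ever used.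
module VS {c ℓ m ℓm : Level} (F : Field c ℓ)
          (M : Module (Field.commutativeRing F) m ℓm) where
  open Field F public renaming (_+_ to _+F_; _*_ to _*F_; -_ to -F_)
  open Module M public

  ∑F : ℕ → (ℕ → Carrier) → Carrier
  ∑F zero    f = 0#
  ∑F (suc n) f = ∑F n f +F f n

  ∑ : ℕ → (ℕ → Carrierᴹ) → Carrierᴹ
  ∑ zero    x = 0ᴹ
  ∑ (suc n) x = ∑ n x +ᴹ x n

  lc : ℕ → (ℕ → Carrier) → (ℕ → Carrierᴹ) → Carrierᴹ
  lc n a x = ∑ n (λ i → a i *ₗ x i)

  LinIndep : ℕ → (ℕ → Carrierᴹ) → Set (c ⊔ ℓ ⊔ ℓm)
  LinIndep n x = ∀ (a : ℕ → Carrier) → lc n a x ≈ᴹ 0ᴹ → ∀ i → i < n → a i ≈ 0#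

  LinDep : ℕ → (ℕ → Carrierᴹ) → Set (c ⊔ ℓ ⊔ ℓm)
  LinDep n x = ∃ λ (a : ℕ → Carrier) → (∃ λ i → i < n × ¬ (a i ≈ 0#)) × lc n a x ≈ᴹ 0ᴹ

  InSpan : ℕ → (ℕ → Carrierᴹ) → Carrierᴹ → Set (c ⊔ ℓm)
  InSpan n x y = ∃ λ (a : ℕ → Carrier) → y ≈ᴹ lc n a x

  -- u 0, ..., u n is a basis of V  (so dim V = n + 1)
  IsBasis : ℕ → (ℕ → Carrierᴹ) → Set (c ⊔ ℓ ⊔ m ⊔ ℓm)
  IsBasis d u = LinIndep (suc d) u × (∀ y → InSpan (suc d) u y)

  Matrix : Set c
  Matrix = ℕ → ℕ → Carrier

  δ : ℕ → ℕ → Carrier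
  δ p q = if p ≡ᵇ q then 1# else 0#

  IsInverse : ℕ → Matrix → Matrix → Set ℓ
  IsInverse n A N =
    (∀ p q → p < n → q < n → ∑F n (λ k → A p k *F N k q) ≈ δ p q) ×
    (∀ p q → p < n → q < n → ∑F n (λ k → N p k *F A k q) ≈ δ p q)

  Invertible : ℕ → Matrix → Set (c ⊔ ℓ)
  Invertible n A = ∃ λ N → IsInverse n A N

  -- T[i,j]: rows 0..j-i, columns i..j  (a (j-i+1)×(j-i+1) matrix)
  sub : Matrix → ℕ → Matrix
  sub T i p q = T p (i + q)

  size : ℕ → ℕ → ℕ
  size i j = suc j ∸ i

  UpperTriangular : ℕ → Matrix → Set ℓ
  UpperTriangular d T = ∀ i j → j < i → i ≤ d → T i j ≈ 0#

  VeryGood : ℕ → Matrix → Set (c ⊔ ℓ)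
  VeryGood d T = ∀ i j → i ≤ j → j ≤ d → Invertible (size i j) (sub T i)

  vOf : ℕ → Matrix → (ℕ → Carrierᴹ) → ℕ → Carrierᴹ
  vOf d T u j = lc (suc d) (λ i → T i j) u

  InU : (ℕ → Carrierᴹ) → ℕ → Carrierᴹ → Set (c ⊔ ℓm)
  InU u i = InSpan (suc i) u

  InU' : ℕ → (ℕ → Carrierᴹ) → ℕ → Carrierᴹ → Set (c ⊔ ℓm)
  InU' d u i = InSpan (suc i) (λ k → u (d ∸ k))

  InU'' : ℕ → (ℕ → Carrierᴹ) → ℕ → Carrierᴹ → Set (c ⊔ ℓm)
  InU'' d v i = InSpan (suc i) (λ k → v (d ∸ k))

  InB : ℕ → Matrix → (ℕ → Carrierᴹ) → ℕ → ℕ → ℕ → Carrierᴹ → Set (c ⊔ ℓm)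
  InB d T u r s t y =
    InU u (d ∸ r) y × InU' d u (d ∸ s) y × InU'' d (vOf d T u) (d ∸ t) y

  SpansB : ℕ → Matrix → (ℕ → Carrierᴹ) → ℕ → ℕ → ℕ → Carrierᴹ → Set (c ⊔ m ⊔ ℓm)
  SpansB d T u r s t y =
    InB d T u r s t y × (∀ z → InB d T u r s t z → ∃ λ a → z ≈ᴹ a *ₗ y)

  -- Concrete Billiard Arrays.  A map Δ_d → V is represented by a function
  -- 𝓑 : ℕ → ℕ → ℕ → V, of which only the values at (r,s,t) with
  -- r + s + t ≡ d are relevant.

  Arr : Set m
  Arr = ℕ → ℕ → ℕ → Carrierᴹ

  three : Carrierᴹ → Carrierᴹ → Carrierᴹ → ℕ → Carrierᴹ
  three x y z 0 = x
  three x y z 1 = y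
  three x y z _ = z

  -- vectors on each line are linearly independent.
  -- line with 1st coordinate k: (k, j, d-k-j), j = 0..d-k; similarly for the others.
  LinesIndep : ℕ → Arr → Set (c ⊔ ℓ ⊔ ℓm)
  LinesIndep d 𝓑 = ∀ k → k ≤ d →
    LinIndep (suc (d ∸ k)) (λ j → 𝓑 k j (d ∸ k ∸ j)) ×
    LinIndep (suc (d ∸ k)) (λ j → 𝓑 j k (d ∸ k ∸ j)) ×
    LinIndep (suc (d ∸ k)) (λ j → 𝓑 j (d ∸ k ∸ j) k)

  CliquesDep : ℕ → Arr → Set (c ⊔ ℓ ⊔ ℓm)
  CliquesDep d 𝓑 = ∀ a b c' → a + b + c' + 1 ≡ d →
    LinDep 3 (three (𝓑 (suc a) b c') (𝓑 a (suc b) c') (𝓑 a b (suc c')))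

  IsConcreteBA : ℕ → Arr → Set (c ⊔ ℓ ⊔ ℓm)
  IsConcreteBA d 𝓑 = LinesIndep d 𝓑 × CliquesDep d 𝓑

  IsStandard : ℕ → Arr → Set (c ⊔ ℓm)
  IsStandard d 𝓑 = ∀ a b c' → a + b + c' + 1 ≡ d →
    ∃ λ α → (𝓑 (suc a) b c' +ᴹ (-ᴹ 𝓑 a (suc b) c')) ≈ᴹ α *ₗ 𝓑 a b (suc c')

  CorrespondsToB : ℕ → Matrix → (ℕ → Carrierᴹ) → Arr → Set (c ⊔ m ⊔ ℓm)
  CorrespondsToB d T u 𝓑 = ∀ r s t → r + s + t ≡ d → SpansB d T u r s t (𝓑 r s t)

module Submission where

-- Write c = cf λ for the v-coordinates of 𝓑_λ, λ = (r,s,t), and T c for its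
-- u-coordinates (u-coordinate p is ∑_j T p j c j).  Membership of 𝓑_λ in the three
-- flags translates into vanishing conditions:
--   * 𝓑_λ ∈ U''_{d-t} = span(v_t,…,v_d)  gives  c i = 0 for i < t;
--   * 𝓑_λ ∈ U_{d-r}                      gives  (T c) p = 0 for p > d-r, hence, T being
--     upper triangular with invertible diagonal, c q = 0 for q > d-r = t+s;
--   * 𝓑_λ ∈ U'_{d-s} = span(u_s,…,u_d)   gives  (T c) p = 0 for p < s.
-- The normalisation 𝓑_{(d-i,0,i)} = v_i and the standard relation
-- 𝓑_{(a+1,b,c)} - 𝓑_{(a,b+1,c)} ∈ F 𝓑_{(a,b,c+1)} give c t = 1 by induction on s.
-- Hence the rows p < s of T c = 0 read  T p t + ∑_k T[t+1,d-r] p k c (t+1+k) = 0, and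
-- multiplying by the inverse of T[t+1,d-r] yields the stated formula.

open import Defs
open import Level using (Level)
open import Data.Nat using (ℕ; zero; suc; _+_; _∸_; _≤_; _<_; z≤n; s≤s; _≤?_)
import Data.Nat.Properties as ℕP
open import Data.Nat.Tactic.RingSolver using (solve-∀)
open import Data.Product using (∃; _,_; proj₁; proj₂; _×_)
open import Relation.Binary.PropositionalEquality as P using (_≡_; _≢_)
open import Algebra.Bundles using (CommutativeMonoid)
open import Algebra.Module.Bundles using (Module)
open import Relation.Nullary using (yes; no)
open import Relation.Binary.Definitions using (tri<; tri≈; tri>)
open import Data.Empty using (⊥-elim)

-- Finite sums S n f = f 0 ∙ … ∙ f (n-1) in a commutative monoid, for any operator S
-- satisfying the defining recursion (both ∑F and ∑ of Defs are instances).
module FiniteSum {a ℓ : Level} (CM : CommutativeMonoid a ℓ)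
  (S : ℕ → (ℕ → CommutativeMonoid.Carrier CM) → CommutativeMonoid.Carrier CM)
  (S-zero : ∀ f → S zero f ≡ CommutativeMonoid.ε CM)
  (S-suc : ∀ n f → S (suc n) f ≡ CommutativeMonoid._∙_ CM (S n f) (f n)) where
  open ℕP
  open CommutativeMonoid CM
  open import Relation.Binary.Reasoning.Setoid setoid

  sum-cong : ∀ n {f g} → (∀ i → i < n → f i ≈ g i) → S n f ≈ S n g
  sum-cong zero {f} {g} h = trans (reflexive (S-zero f)) (sym (reflexive (S-zero g)))
  sum-cong (suc n) {f} {g} h = begin
    S (suc n) f ≈⟨ reflexive (S-suc n f) ⟩
    S n f ∙ f n ≈⟨ ∙-cong (sum-cong n (λ i i<n → h i (m≤n⇒m≤1+n i<n))) (h n ≤-refl) ⟩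
    S n g ∙ g n ≈⟨ sym (reflexive (S-suc n g)) ⟩
    S (suc n) g ∎

  sum-vanishes : ∀ n {f} → (∀ i → i < n → f i ≈ ε) → S n f ≈ ε
  sum-vanishes zero {f} h = reflexive (S-zero f)
  sum-vanishes (suc n) {f} h = begin
    S (suc n) f ≈⟨ reflexive (S-suc n f) ⟩
    S n f ∙ f n ≈⟨ ∙-cong (sum-vanishes n (λ i i<n → h i (m≤n⇒m≤1+n i<n))) (h n ≤-refl) ⟩
    ε ∙ ε ≈⟨ identityˡ ε ⟩
    ε ∎

  interchange : ∀ x y z w → (x ∙ y) ∙ (z ∙ w) ≈ (x ∙ z) ∙ (y ∙ w)
  interchange x y z w = begin
    (x ∙ y) ∙ (z ∙ w) ≈⟨ assoc x y (z ∙ w) ⟩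
    x ∙ (y ∙ (z ∙ w)) ≈⟨ ∙-congˡ (sym (assoc y z w)) ⟩
    x ∙ ((y ∙ z) ∙ w) ≈⟨ ∙-congˡ (∙-congʳ (comm y z)) ⟩
    x ∙ ((z ∙ y) ∙ w) ≈⟨ ∙-congˡ (assoc z y w) ⟩
    x ∙ (z ∙ (y ∙ w)) ≈⟨ sym (assoc x z (y ∙ w)) ⟩
    (x ∙ z) ∙ (y ∙ w) ∎

  sum-∙ : ∀ n f g → S n (λ i → f i ∙ g i) ≈ S n f ∙ S n g
  sum-∙ zero f g = begin
    S zero _ ≈⟨ reflexive (S-zero _) ⟩
    ε ≈⟨ sym (identityˡ ε) ⟩
    ε ∙ ε ≈⟨ sym (∙-cong (reflexive (S-zero f)) (reflexive (S-zero g))) ⟩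
    S zero f ∙ S zero g ∎
  sum-∙ (suc n) f g = begin
    S (suc n) _ ≈⟨ reflexive (S-suc n _) ⟩
    S n (λ i → f i ∙ g i) ∙ (f n ∙ g n) ≈⟨ ∙-congʳ (sum-∙ n f g) ⟩
    (S n f ∙ S n g) ∙ (f n ∙ g n) ≈⟨ interchange _ _ _ _ ⟩
    (S n f ∙ f n) ∙ (S n g ∙ g n) ≈⟨ sym (∙-cong (reflexive (S-suc n f)) (reflexive (S-suc n g))) ⟩
    S (suc n) f ∙ S (suc n) g ∎

  sum-split : ∀ b m f → S (b + m) f ≈ S b f ∙ S m (λ k → f (b + k))
  sum-split b zero f = begin
    S (b + 0) f ≈⟨ reflexive (P.cong (λ x → S x f) (+-identityʳ b)) ⟩
    S b f ≈⟨ sym (identityʳ _) ⟩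
    S b f ∙ ε ≈⟨ ∙-congˡ (sym (reflexive (S-zero _))) ⟩
    S b f ∙ S zero _ ∎
  sum-split b (suc m) f = begin
    S (b + suc m) f ≈⟨ reflexive (P.cong (λ x → S x f) (+-suc b m)) ⟩
    S (suc (b + m)) f ≈⟨ reflexive (S-suc _ f) ⟩
    S (b + m) f ∙ f (b + m) ≈⟨ ∙-congʳ (sum-split b m f) ⟩
    (S b f ∙ S m (λ k → f (b + k))) ∙ f (b + m) ≈⟨ assoc _ _ _ ⟩
    S b f ∙ (S m (λ k → f (b + k)) ∙ f (b + m)) ≈⟨ ∙-congˡ (sym (reflexive (S-suc m _))) ⟩
    S b f ∙ S (suc m) (λ k → f (b + k)) ∎

  sum-head : ∀ n f → S (suc n) f ≈ f 0 ∙ S n (λ k → f (suc k))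
  sum-head n f = trans (sum-split 1 n f) (∙-congʳ (trans (reflexive (S-suc 0 f))
      (trans (∙-congʳ (reflexive (S-zero f))) (identityˡ _))))

  sum-swap : ∀ n m (f : ℕ → ℕ → Carrier) →
    S n (λ i → S m (λ j → f i j)) ≈ S m (λ j → S n (λ i → f i j))
  sum-swap zero m f = begin
    S zero _ ≈⟨ reflexive (S-zero _) ⟩
    ε ≈⟨ sym (sum-vanishes m (λ j _ → reflexive (S-zero _))) ⟩
    S m (λ j → S zero (λ i → f i j)) ∎
  sum-swap (suc n) m f = begin
    S (suc n) _ ≈⟨ reflexive (S-suc n _) ⟩
    S n (λ i → S m (λ j → f i j)) ∙ S m (λ j → f n j) ≈⟨ ∙-congʳ (sum-swap n m f) ⟩
    S m (λ j → S n (λ i → f i j)) ∙ S m (λ j → f n j) ≈⟨ sym (sum-∙ m _ _) ⟩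
    S m (λ j → S n (λ i → f i j) ∙ f n j) ≈⟨ sum-cong m (λ j _ → sym (reflexive (S-suc n _))) ⟩
    S m (λ j → S (suc n) (λ i → f i j)) ∎

  sum-reverse : ∀ e f → S (suc e) f ≈ S (suc e) (λ k → f (e ∸ k))
  sum-reverse zero f = sum-cong 1 (λ { zero _ → refl ; (suc k) (s≤s ()) })
  sum-reverse (suc e) f = begin
    S (suc (suc e)) f ≈⟨ reflexive (S-suc _ f) ⟩
    S (suc e) f ∙ f (suc e) ≈⟨ ∙-congʳ (sum-reverse e f) ⟩
    S (suc e) (λ k → f (e ∸ k)) ∙ f (suc e) ≈⟨ comm _ _ ⟩
    f (suc e) ∙ S (suc e) (λ k → f (e ∸ k)) ≈⟨ sym (sum-head (suc e) _) ⟩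
    S (suc (suc e)) (λ k → f (suc e ∸ k)) ∎

  sum-window : ∀ n b m f → b + m ≤ n → (∀ i → i < b → f i ≈ ε) →
    (∀ i → b + m ≤ i → i < n → f i ≈ ε) → S n f ≈ S m (λ k → f (b + k))
  sum-window n b m f le below above with m≤n⇒∃[o]m+o≡n le
  ... | e , P.refl = begin
    S (b + m + e) f ≈⟨ sum-split (b + m) e f ⟩
    S (b + m) f ∙ S e (λ k → f (b + m + k)) ≈⟨ ∙-cong (sum-split b m f)
         (sum-vanishes e (λ k k<e → above _ (m≤m+n _ _) (+-monoʳ-< (b + m) k<e))) ⟩
    (S b f ∙ S m (λ k → f (b + k))) ∙ ε ≈⟨ identityʳ _ ⟩
    S b f ∙ S m (λ k → f (b + k)) ≈⟨ ∙-congʳ (sum-vanishes b below) ⟩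
    ε ∙ S m (λ k → f (b + k)) ≈⟨ identityˡ _ ⟩
    S m (λ k → f (b + k)) ∎

  sum-single : ∀ n i f → i < n → (∀ j → j < n → j ≢ i → f j ≈ ε) → S n f ≈ f i
  sum-single n i f i<n h = begin
    S n f ≈⟨ sum-window n i 1 f (P.subst (_≤ n) (P.sym (+-comm i 1)) i<n)
               (λ j j<i → h j (<-trans j<i i<n) (<⇒≢ j<i))
               (λ j le j<n → h j j<n (λ eq → <-irrefl (P.sym eq) (P.subst (_≤ j) (+-comm i 1) le))) ⟩
    S 1 (λ k → f (i + k)) ≈⟨ reflexive (S-suc 0 _) ⟩
    S 0 _ ∙ f (i + 0) ≈⟨ ∙-cong (reflexive (S-zero _)) (reflexive (P.cong f (+-identityʳ i))) ⟩
    ε ∙ f i ≈⟨ identityˡ _ ⟩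
    f i ∎

downward-induction : ∀ {p} (d : ℕ) (P : ℕ → Set p) →
  (∀ q → q ≤ d → (∀ j → q < j → j ≤ d → P j) → P q) → ∀ q → q ≤ d → P q
downward-induction d P step q q≤d = go (suc d) q q≤d (ℕP.m≤m+n (suc d) q)
  where
  -- the fuel bounds the number of indices above q
  go : ∀ fuel q → q ≤ d → d < fuel + q → P q
  go zero q q≤d d<q = ⊥-elim (ℕP.<-irrefl P.refl (ℕP.<-≤-trans d<q q≤d))
  go (suc fuel) q q≤d d<fuel+q = step q q≤d λ j q<j j≤d →
    go fuel j j≤d (ℕP.<-≤-trans d<fuel+q
      (P.subst (_≤ fuel + j) (ℕP.+-suc fuel q) (ℕP.+-monoʳ-≤ fuel q<j)))

module LinearAlgebra {c ℓ m ℓm : Level} (F : Field c ℓ)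
         (M : Module (Field.commutativeRing F) m ℓm) where
  open VS F M
  module ΣF = FiniteSum +-commutativeMonoid ∑F (λ _ → P.refl) (λ _ _ → P.refl)
  module ΣM = FiniteSum +ᴹ-commutativeMonoid ∑ (λ _ → P.refl) (λ _ _ → P.refl)
  open import Algebra.Properties.Ring ring using (-‿distribʳ-*; -0#≈0#)
  open import Algebra.Properties.AbelianGroup +-abelianGroup
    using (⁻¹-∙-comm; x∙y⁻¹≈ε⇒x≈y; inverseʳ-unique)

  module Scalars where
    open import Relation.Binary.Reasoning.Setoid setoid

    *-distrib-∑F : ∀ n x f → x *F ∑F n f ≈ ∑F n (λ i → x *F f i)
    *-distrib-∑F zero x f = zeroʳ x
    *-distrib-∑F (suc n) x f = begin
      x *F (∑F n f +F f n) ≈⟨ distribˡ x _ _ ⟩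
      x *F ∑F n f +F x *F f n ≈⟨ +-congʳ (*-distrib-∑F n x f) ⟩
      ∑F n (λ i → x *F f i) +F x *F f n ∎

    ∑F-distrib-* : ∀ n x f → ∑F n f *F x ≈ ∑F n (λ i → f i *F x)
    ∑F-distrib-* n x f = trans (*-comm _ x)
      (trans (*-distrib-∑F n x f) (ΣF.sum-cong n (λ i _ → *-comm x (f i))))

    ∑F-neg : ∀ n f → ∑F n (λ i → -F f i) ≈ -F ∑F n f
    ∑F-neg zero f = sym -0#≈0#
    ∑F-neg (suc n) f = begin
      ∑F n (λ i → -F f i) +F -F f n ≈⟨ +-congʳ (∑F-neg n f) ⟩
      -F ∑F n f +F -F f n ≈⟨ ⁻¹-∙-comm _ _ ⟩
      -F (∑F n f +F f n) ∎

    δ-diag : ∀ i → δ i i ≈ 1#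
    δ-diag zero = refl
    δ-diag (suc i) = δ-diag i

    δ-off : ∀ i j → i ≢ j → δ i j ≈ 0#
    δ-off zero zero i≢j = ⊥-elim (i≢j P.refl)
    δ-off zero (suc j) i≢j = refl
    δ-off (suc i) zero i≢j = refl
    δ-off (suc i) (suc j) i≢j = δ-off i j (λ eq → i≢j (P.cong suc eq))

    ∑F-δ : ∀ n i (w : ℕ → Carrier) → i < n → ∑F n (λ j → δ i j *F w j) ≈ w i
    ∑F-δ n i w i<n = trans (ΣF.sum-single n i _ i<n
        (λ j _ j≢i → trans (*-congʳ (δ-off i j (λ eq → j≢i (P.sym eq)))) (zeroˡ _)))
      (trans (*-congʳ (δ-diag i)) (*-identityˡ _))

    left-inverse-recovers : ∀ n (N A : Matrix) →
      (∀ k l → k < n → l < n → ∑F n (λ q → N k q *F A q l) ≈ δ k l) →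
      ∀ (w : ℕ → Carrier) k → k < n → w k ≈ ∑F n (λ l → N k l *F ∑F n (λ q → A l q *F w q))
    left-inverse-recovers n N A NA≈I w k k<n = sym (begin
      ∑F n (λ l → N k l *F ∑F n (λ q → A l q *F w q)) ≈⟨ ΣF.sum-cong n (λ l _ → *-distrib-∑F n _ _) ⟩
      ∑F n (λ l → ∑F n (λ q → N k l *F (A l q *F w q))) ≈⟨ ΣF.sum-swap n n _ ⟩
      ∑F n (λ q → ∑F n (λ l → N k l *F (A l q *F w q))) ≈⟨ ΣF.sum-cong n (λ q _ →
           ΣF.sum-cong n (λ l _ → sym (*-assoc _ _ _))) ⟩
      ∑F n (λ q → ∑F n (λ l → (N k l *F A l q) *F w q)) ≈⟨ ΣF.sum-cong n (λ q _ → sym (∑F-distrib-* n _ _)) ⟩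
      ∑F n (λ q → ∑F n (λ l → N k l *F A l q) *F w q) ≈⟨ ΣF.sum-cong n (λ q q<n → *-congʳ (NA≈I k q k<n q<n)) ⟩
      ∑F n (λ q → δ k q *F w q) ≈⟨ ∑F-δ n k w k<n ⟩
      w k ∎)

    solve-by-left-inverse : ∀ n (N A : Matrix) (b w : ℕ → Carrier) →
      (∀ k l → k < n → l < n → ∑F n (λ q → N k q *F A q l) ≈ δ k l) →
      (∀ p → p < n → b p +F ∑F n (λ q → A p q *F w q) ≈ 0#) →
      ∀ k → k < n → w k ≈ -F ∑F n (λ l → N k l *F b l)
    solve-by-left-inverse n N A b w NA≈I Aw+b≈0 k k<n = begin
      w k ≈⟨ left-inverse-recovers n N A NA≈I w k k<n ⟩
      ∑F n (λ l → N k l *F ∑F n (λ q → A l q *F w q)) ≈⟨ ΣF.sum-cong n (λ l l<n →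
          *-congˡ (inverseʳ-unique _ _ (Aw+b≈0 l l<n))) ⟩
      ∑F n (λ l → N k l *F -F b l) ≈⟨ ΣF.sum-cong n (λ l _ → sym (-‿distribʳ-* _ _)) ⟩
      ∑F n (λ l → -F (N k l *F b l)) ≈⟨ ∑F-neg n _ ⟩
      -F ∑F n (λ l → N k l *F b l) ∎

  open Scalars public

  module Vectors where
    open import Relation.Binary.Reasoning.Setoid ≈ᴹ-setoid

    *ₗ-distrib-∑ : ∀ n x f → x *ₗ ∑ n f ≈ᴹ ∑ n (λ i → x *ₗ f i)
    *ₗ-distrib-∑ zero x f = *ₗ-zeroʳ x
    *ₗ-distrib-∑ (suc n) x f = begin
      x *ₗ (∑ n f +ᴹ f n) ≈⟨ *ₗ-distribˡ x _ _ ⟩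
      x *ₗ ∑ n f +ᴹ x *ₗ f n ≈⟨ +ᴹ-congʳ (*ₗ-distrib-∑ n x f) ⟩
      ∑ n (λ i → x *ₗ f i) +ᴹ x *ₗ f n ∎

    ∑F-distrib-*ₗ : ∀ n f y → ∑F n f *ₗ y ≈ᴹ ∑ n (λ i → f i *ₗ y)
    ∑F-distrib-*ₗ zero f y = *ₗ-zeroˡ y
    ∑F-distrib-*ₗ (suc n) f y = begin
      (∑F n f +F f n) *ₗ y ≈⟨ *ₗ-distribʳ y _ _ ⟩
      ∑F n f *ₗ y +ᴹ f n *ₗ y ≈⟨ +ᴹ-congʳ (∑F-distrib-*ₗ n f y) ⟩
      ∑ n (λ i → f i *ₗ y) +ᴹ f n *ₗ y ∎

    lc-cong : ∀ n {a b} x → (∀ i → i < n → a i ≈ b i) → lc n a x ≈ᴹ lc n b x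
    lc-cong n x h = ΣM.sum-cong n (λ i i<n → *ₗ-congʳ (h i i<n))

    lc-zero : ∀ n a x → (∀ i → i < n → a i ≈ 0#) → lc n a x ≈ᴹ 0ᴹ
    lc-zero n a x h = ΣM.sum-vanishes n (λ i i<n → ≈ᴹ-trans (*ₗ-congʳ (h i i<n)) (*ₗ-zeroˡ _))

    lc-+ : ∀ n a b x → lc n (λ i → a i +F b i) x ≈ᴹ lc n a x +ᴹ lc n b x
    lc-+ n a b x = ≈ᴹ-trans (ΣM.sum-cong n (λ i _ → *ₗ-distribʳ (x i) (a i) (b i))) (ΣM.sum-∙ n _ _)

    lc-scale : ∀ n α a x → α *ₗ lc n a x ≈ᴹ lc n (λ i → α *F a i) x
    lc-scale n α a x = ≈ᴹ-trans (*ₗ-distrib-∑ n α _)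
      (ΣM.sum-cong n (λ i _ → ≈ᴹ-sym (*ₗ-assoc α (a i) (x i))))

    lc-δ : ∀ n t x → t < n → x t ≈ᴹ lc n (δ t) x
    lc-δ n t x t<n = ≈ᴹ-sym (≈ᴹ-trans (ΣM.sum-single n t (λ j → δ t j *ₗ x j) t<n
        (λ j _ j≢t → ≈ᴹ-trans (*ₗ-congʳ (δ-off t j (λ e → j≢t (P.sym e)))) (*ₗ-zeroˡ _)))
        (≈ᴹ-trans (*ₗ-congʳ (δ-diag t)) (*ₗ-identityˡ _)))

    coords-unique : ∀ n x → LinIndep n x → ∀ a b → lc n a x ≈ᴹ lc n b x → ∀ i → i < n → a i ≈ b i
    coords-unique n x indep a b h i i<n =
      x∙y⁻¹≈ε⇒x≈y (a i) (b i) (indep (λ j → a j +F -F b j) a-b≈0 i i<n)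
      where
      a-b≈0 : lc n (λ j → a j +F -F b j) x ≈ᴹ 0ᴹ
      a-b≈0 = begin
        lc n (λ j → a j +F -F b j) x ≈⟨ lc-+ n a _ x ⟩
        lc n a x +ᴹ lc n (λ j → -F b j) x ≈⟨ +ᴹ-congʳ h ⟩
        lc n b x +ᴹ lc n (λ j → -F b j) x ≈⟨ ≈ᴹ-sym (lc-+ n b _ x) ⟩
        lc n (λ j → b j +F -F b j) x ≈⟨ lc-zero n _ x (λ j _ → -‿inverseʳ (b j)) ⟩
        0ᴹ ∎

  open Vectors public

  -- A combination of x 0 … x e is a combination of
  -- x 0 … x (n-1) whose coefficients above e vanish (prefix-pad), and a combination of
  -- x d, x (d-1), … x (d-e) is a combination of x 0 … x d whose coefficients below d-e
  -- vanish (reverse-pad).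
  prefix-pad : ℕ → (ℕ → Carrier) → ℕ → Carrier
  prefix-pad e a i with i ≤? e
  ... | yes _ = a i
  ... | no _ = 0#

  prefix-pad-in : ∀ e a i → i ≤ e → prefix-pad e a i ≈ a i
  prefix-pad-in e a i i≤e with i ≤? e
  ... | yes _ = refl
  ... | no i≰e = ⊥-elim (i≰e i≤e)

  prefix-pad-out : ∀ e a i → e < i → prefix-pad e a i ≈ 0#
  prefix-pad-out e a i e<i with i ≤? e
  ... | yes i≤e = ⊥-elim (ℕP.<-irrefl P.refl (ℕP.<-≤-trans e<i i≤e))
  ... | no _ = refl

  reverse-pad : ℕ → ℕ → (ℕ → Carrier) → ℕ → Carrier
  reverse-pad d e a i with (d ∸ e) ≤? i
  ... | yes _ = a (d ∸ i)
  ... | no _ = 0#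

  reverse-pad-in : ∀ d e a i → d ∸ e ≤ i → reverse-pad d e a i ≈ a (d ∸ i)
  reverse-pad-in d e a i le with (d ∸ e) ≤? i
  ... | yes _ = refl
  ... | no ≰ = ⊥-elim (≰ le)

  reverse-pad-out : ∀ d e a i → i < d ∸ e → reverse-pad d e a i ≈ 0#
  reverse-pad-out d e a i lt with (d ∸ e) ≤? i
  ... | yes le = ⊥-elim (ℕP.<-irrefl P.refl (ℕP.<-≤-trans lt le))
  ... | no _ = refl

  module Padding where
    open import Relation.Binary.Reasoning.Setoid ≈ᴹ-setoid

    lc-prefix : ∀ n e → e < n → ∀ a x → lc (suc e) a x ≈ᴹ lc n (prefix-pad e a) x
    lc-prefix n e e<n a x = ≈ᴹ-sym (begin
      lc n (prefix-pad e a) x ≈⟨ ΣM.sum-window n 0 (suc e) _ e<n (λ i ())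
          (λ i e<i _ → ≈ᴹ-trans (*ₗ-congʳ (prefix-pad-out e a i e<i)) (*ₗ-zeroˡ _)) ⟩
      lc (suc e) (prefix-pad e a) x ≈⟨ lc-cong (suc e) x (λ k k<se → prefix-pad-in e a k (ℕP.≤-pred k<se)) ⟩
      lc (suc e) a x ∎)

    lc-reverse : ∀ d e → e ≤ d → ∀ a (x : ℕ → Carrierᴹ) →
      lc (suc e) a (λ k → x (d ∸ k)) ≈ᴹ lc (suc d) (reverse-pad d e a) x
    lc-reverse d e e≤d a x = begin
      ∑ (suc e) (λ k → a k *ₗ x (d ∸ k)) ≈⟨ ΣM.sum-cong (suc e) (λ k k<se → reindex k (ℕP.≤-pred k<se)) ⟩
      ∑ (suc e) (λ k → g (e ∸ k)) ≈⟨ ≈ᴹ-sym (ΣM.sum-reverse e g) ⟩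
      ∑ (suc e) g ≈⟨ ΣM.sum-cong (suc e) (λ k _ → *ₗ-congʳ (sym (pad-window k))) ⟩
      ∑ (suc e) (λ k → reverse-pad d e a (b + k) *ₗ x (b + k)) ≈⟨ ≈ᴹ-sym (ΣM.sum-window (suc d) b (suc e) _
          (P.subst (_≤ suc d) (P.sym b+1+e≡1+d) ℕP.≤-refl)
          (λ i i<b → ≈ᴹ-trans (*ₗ-congʳ (reverse-pad-out d e a i i<b)) (*ₗ-zeroˡ _))
          (λ i le i<n → ⊥-elim (ℕP.<-irrefl P.refl (ℕP.<-≤-trans i<n (P.subst (_≤ i) b+1+e≡1+d le))))) ⟩
      lc (suc d) (reverse-pad d e a) x ∎
      where
      b = d ∸ e
      b+e≡d : b + e ≡ d
      b+e≡d = ℕP.m∸n+n≡m e≤d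
      b+1+e≡1+d : b + suc e ≡ suc d
      b+1+e≡1+d = P.trans (ℕP.+-suc b e) (P.cong suc b+e≡d)
      -- the summands listed from index b = d - e upwards
      g : ℕ → Carrierᴹ
      g j = a (e ∸ j) *ₗ x (b + j)
      reindex : ∀ k → k ≤ e → a k *ₗ x (d ∸ k) ≈ᴹ g (e ∸ k)
      reindex k k≤e = *ₗ-cong (reflexive (P.cong a (P.sym (ℕP.m∸[m∸n]≡n k≤e))))
        (≈ᴹ-reflexive (P.cong x (P.trans (P.cong (_∸ k) (P.sym b+e≡d)) (ℕP.+-∸-assoc b k≤e))))
      pad-window : ∀ k → reverse-pad d e a (b + k) ≈ a (e ∸ k)
      pad-window k = trans (reverse-pad-in d e a (b + k) (ℕP.m≤m+n b k))
        (reflexive (P.cong a (P.trans (P.cong (_∸ (b + k)) (P.sym b+e≡d)) (ℕP.[m+n]∸[m+o]≡n∸o b e k))))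

  open Padding public

module ChangeOfBasis {c ℓ m ℓm : Level} (F : Field c ℓ)
         (M : Module (Field.commutativeRing F) m ℓm)
         (d : ℕ) (T : VS.Matrix F M) (u : ℕ → Module.Carrierᴹ M) where
  open VS F M
  open LinearAlgebra F M

  n : ℕ
  n = suc d

  v : ℕ → Carrierᴹ
  v = vOf d T u

  -- the u-coordinates T c of the vector whose v-coordinates are c
  uCoord : (ℕ → Carrier) → ℕ → Carrier
  uCoord cs p = ∑F n (λ j → T p j *F cs j)

  module Translation where
    open import Relation.Binary.Reasoning.Setoid ≈ᴹ-setoid

    v-to-u : ∀ cs → lc n cs v ≈ᴹ lc n (uCoord cs) u
    v-to-u cs = begin
      ∑ n (λ j → cs j *ₗ ∑ n (λ p → T p j *ₗ u p)) ≈⟨ ΣM.sum-cong n (λ j _ → *ₗ-distrib-∑ n (cs j) _) ⟩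
      ∑ n (λ j → ∑ n (λ p → cs j *ₗ (T p j *ₗ u p))) ≈⟨ ΣM.sum-cong n (λ j _ → ΣM.sum-cong n (λ p _ →
            ≈ᴹ-trans (≈ᴹ-sym (*ₗ-assoc (cs j) (T p j) (u p))) (*ₗ-congʳ (*-comm (cs j) (T p j))))) ⟩
      ∑ n (λ j → ∑ n (λ p → (T p j *F cs j) *ₗ u p)) ≈⟨ ΣM.sum-swap n n _ ⟩
      ∑ n (λ p → ∑ n (λ j → (T p j *F cs j) *ₗ u p)) ≈⟨ ΣM.sum-cong n (λ p _ → ≈ᴹ-sym (∑F-distrib-*ₗ n _ (u p))) ⟩
      ∑ n (λ p → uCoord cs p *ₗ u p) ∎

  open Translation public

  -- v-coordinates are unique when u is independent and T is invertible: equal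
  -- u-coordinates T a = T b give a = N T a = N T b = b
  v-coords-unique : LinIndep n u → Invertible n T →
    ∀ a b → lc n a v ≈ᴹ lc n b v → ∀ i → i < n → a i ≈ b i
  v-coords-unique indep (N , _ , NT≈I) a b h i i<n =
    trans (left-inverse-recovers n N T NT≈I a i i<n)
      (trans (ΣF.sum-cong n (λ p p<n → *-congˡ (coords-unique n u indep (uCoord a) (uCoord b)
                (≈ᴹ-trans (≈ᴹ-sym (v-to-u a)) (≈ᴹ-trans h (v-to-u b))) p p<n)))
        (sym (left-inverse-recovers n N T NT≈I b i i<n)))

  -- the diagonal entries of a very good upper triangular matrix are invertible:
  -- row p of T[0,p] N = I reads T p p * N p p = 1
  diagonal-invertible : UpperTriangular d T → VeryGood d T →
    ∀ p → p ≤ d → ∃ λ w → w *F T p p ≈ 1#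
  diagonal-invertible UT VG p p≤d with VG 0 p z≤n p≤d
  ... | N , TN≈I , _ = N p p , trans (*-comm _ _) (trans (sym (ΣF.sum-single (suc p) p _ ℕP.≤-refl
        (λ k k<sp k≢p → trans (*-congʳ (UT p k (ℕP.≤∧≢⇒< (ℕP.≤-pred k<sp) k≢p) p≤d)) (zeroˡ _))))
        (trans (TN≈I p p ℕP.≤-refl ℕP.≤-refl) (δ-diag p)))

  upper-triangular-solve : UpperTriangular d T → VeryGood d T →
    ∀ e cs → (∀ p → p ≤ d → e < p → uCoord cs p ≈ 0#) → ∀ q → q ≤ d → e < q → cs q ≈ 0#
  upper-triangular-solve UT VG e cs rows≈0 =
    downward-induction d (λ q → e < q → cs q ≈ 0#) step
    where
    step : ∀ q → q ≤ d → (∀ j → q < j → j ≤ d → e < j → cs j ≈ 0#) → e < q → cs q ≈ 0#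
    step q q≤d above e<q with diagonal-invertible UT VG q q≤d
    ... | w , wT≈1 = begin
        cs q ≈⟨ sym (*-identityˡ _) ⟩
        1# *F cs q ≈⟨ *-congʳ (sym wT≈1) ⟩
        (w *F T q q) *F cs q ≈⟨ *-assoc _ _ _ ⟩
        w *F (T q q *F cs q) ≈⟨ *-congˡ (trans (sym row-q) (rows≈0 q q≤d e<q)) ⟩
        w *F 0# ≈⟨ zeroʳ w ⟩
        0# ∎
      where
      open import Relation.Binary.Reasoning.Setoid setoid
      -- row q of T c only sees c q: T q j = 0 for j < q, and c j = 0 for j > q
      row-q : uCoord cs q ≈ T q q *F cs q
      row-q = ΣF.sum-single n q (λ j → T q j *F cs j) (s≤s q≤d) off-diagonal
        where
        off-diagonal : ∀ j → j < n → j ≢ q → T q j *F cs j ≈ 0#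
        off-diagonal j j<n j≢q with ℕP.<-cmp j q
        ... | tri< j<q _ _ = trans (*-congʳ (UT q j j<q q≤d)) (zeroˡ _)
        ... | tri≈ _ j≡q _ = ⊥-elim (j≢q j≡q)
        ... | tri> _ _ q<j = trans (*-congˡ (above j q<j (ℕP.≤-pred j<n) (ℕP.<-trans e<q q<j))) (zeroʳ _)

  inU-coords : LinIndep n u → ∀ e → e ≤ d → ∀ y cs → InU u e y → y ≈ᴹ lc n cs v →
    ∀ p → p ≤ d → e < p → uCoord cs p ≈ 0#
  inU-coords indep e e≤d y cs (a , y≈a) y≈cs p p≤d e<p =
    trans (coords-unique n u indep (uCoord cs) (prefix-pad e a)
        (≈ᴹ-trans (≈ᴹ-sym (v-to-u cs)) (≈ᴹ-trans (≈ᴹ-sym y≈cs)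
          (≈ᴹ-trans y≈a (lc-prefix n e (s≤s e≤d) a u)))) p (s≤s p≤d))
      (prefix-pad-out e a p e<p)

  inU'-coords : LinIndep n u → ∀ s → s ≤ d → ∀ y cs → InU' d u (d ∸ s) y → y ≈ᴹ lc n cs v →
    ∀ p → p < s → uCoord cs p ≈ 0#
  inU'-coords indep s s≤d y cs (a , y≈a) y≈cs p p<s =
    trans (coords-unique n u indep (uCoord cs) (reverse-pad d (d ∸ s) a)
        (≈ᴹ-trans (≈ᴹ-sym (v-to-u cs)) (≈ᴹ-trans (≈ᴹ-sym y≈cs)
          (≈ᴹ-trans y≈a (lc-reverse d (d ∸ s) (ℕP.m∸n≤m d s) a u)))) p
        (ℕP.<-≤-trans p<s (ℕP.m≤n⇒m≤1+n s≤d)))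
      (reverse-pad-out d (d ∸ s) a p (P.subst (p <_) (P.sym (ℕP.m∸[m∸n]≡n s≤d)) p<s))

  inU''-coords : LinIndep n u → Invertible n T → ∀ t → t ≤ d → ∀ y cs →
    InU'' d v (d ∸ t) y → y ≈ᴹ lc n cs v → ∀ i → i < t → cs i ≈ 0#
  inU''-coords indep T-inv t t≤d y cs (a , y≈a) y≈cs i i<t =
    trans (v-coords-unique indep T-inv cs (reverse-pad d (d ∸ t) a)
        (≈ᴹ-trans (≈ᴹ-sym y≈cs) (≈ᴹ-trans y≈a (lc-reverse d (d ∸ t) (ℕP.m∸n≤m d t) a v))) i
        (ℕP.<-≤-trans i<t (ℕP.m≤n⇒m≤1+n t≤d)))
      (reverse-pad-out d (d ∸ t) a i (P.subst (i <_) (P.sym (ℕP.m∸[m∸n]≡n t≤d)) i<t))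

  uCoord-window : ∀ t s cs → t + s ≤ d → (∀ i → i < t → cs i ≈ 0#) → cs t ≈ 1# →
    (∀ q → q ≤ d → t + s < q → cs q ≈ 0#) →
    ∀ p → uCoord cs p ≈ T p t +F ∑F s (λ k → sub T (suc t) p k *F cs (suc t + k))
  uCoord-window t s cs t+s≤d below at-t above p = begin
    uCoord cs p ≈⟨ ΣF.sum-window n t (suc s) _ (P.subst (_≤ n) (P.sym (ℕP.+-suc t s)) (s≤s t+s≤d))
                (λ i i<t → trans (*-congˡ (below i i<t)) (zeroʳ _))
                (λ i le i<n → trans (*-congˡ (above i (ℕP.≤-pred i<n)
                    (P.subst (_≤ i) (ℕP.+-suc t s) le))) (zeroʳ _)) ⟩
    ∑F (suc s) (λ k → T p (t + k) *F cs (t + k)) ≈⟨ ΣF.sum-head s _ ⟩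
    T p (t + 0) *F cs (t + 0) +F ∑F s (λ k → T p (t + suc k) *F cs (t + suc k)) ≈⟨ +-cong
        (trans (reflexive (P.cong (λ z → T p z *F cs z) (ℕP.+-identityʳ t)))
               (trans (*-congˡ at-t) (*-identityʳ _)))
        (ΣF.sum-cong s (λ k _ → reflexive (P.cong (λ z → T p z *F cs z) (ℕP.+-suc t k)))) ⟩
    T p t +F ∑F s (λ k → sub T (suc t) p k *F cs (suc t + k)) ∎
    where open import Relation.Binary.Reasoning.Setoid setoid

shift-r : ∀ r s t → suc r + s + t ≡ r + s + t + 1
shift-r = solve-∀

shift-s : ∀ r s t → r + suc s + t ≡ r + s + t + 1
shift-s = solve-∀

shift-t : ∀ r s t → r + s + suc t ≡ r + s + t + 1
shift-t = solve-∀

regroup-t+s : ∀ r s t → r + s + t ≡ r + (t + s)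
regroup-t+s = solve-∀

regroup-s : ∀ r s t → r + s + t ≡ s + (r + t)
regroup-s = solve-∀

module StandardArray {c ℓ m ℓm : Level} (F : Field c ℓ)
         (M : Module (Field.commutativeRing F) m ℓm)
         (d : ℕ) (T : VS.Matrix F M) (u : ℕ → Module.Carrierᴹ M)
         (UT : VS.UpperTriangular F M d T) (VG : VS.VeryGood F M d T) (BA : VS.IsBasis F M d u)
         (𝓑 : VS.Arr F M) (std : VS.IsStandard F M d 𝓑) (corr : VS.CorrespondsToB F M d T u 𝓑)
         (norm : ∀ i → i ≤ d → Module._≈ᴹ_ M (𝓑 (d ∸ i) 0 i) (VS.vOf F M d T u i))
         (cf : ℕ → ℕ → ℕ → ℕ → Field.Carrier F)
         (cfH : ∀ r s t → r + s + t ≡ d →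
                  Module._≈ᴹ_ M (𝓑 r s t) (VS.lc F M (suc d) (cf r s t) (VS.vOf F M d T u)))
         where
  open VS F M
  open LinearAlgebra F M
  open ChangeOfBasis F M d T u

  u-indep : LinIndep n u
  u-indep = proj₁ BA

  T-invertible : Invertible n T
  T-invertible = VG 0 d z≤n ℕP.≤-refl

  t≤d : ∀ {r s t} → r + s + t ≡ d → t ≤ d
  t≤d {r} {s} {t} eq = P.subst (t ≤_) eq (ℕP.m≤n+m t (r + s))

  s≤d : ∀ {r s t} → r + s + t ≡ d → s ≤ d
  s≤d {r} {s} {t} eq = P.subst (s ≤_) (P.trans (P.sym (regroup-s r s t)) eq) (ℕP.m≤m+n s (r + t))

  cf-below-t : ∀ r s t → r + s + t ≡ d → ∀ i → i < t → cf r s t i ≈ 0#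
  cf-below-t r s t eq = inU''-coords u-indep T-invertible t (t≤d {r} {s} eq) _ (cf r s t)
    (proj₂ (proj₂ (proj₁ (corr r s t eq)))) (cfH r s t eq)

  cf-above : ∀ r s t → r + s + t ≡ d → ∀ q → q ≤ d → d ∸ r < q → cf r s t q ≈ 0#
  cf-above r s t eq = upper-triangular-solve UT VG (d ∸ r) (cf r s t)
    (inU-coords u-indep (d ∸ r) (ℕP.m∸n≤m d r) _ (cf r s t) (proj₁ (proj₁ (corr r s t eq))) (cfH r s t eq))

  uCoord-below-s : ∀ r s t → r + s + t ≡ d → ∀ p → p < s → uCoord (cf r s t) p ≈ 0#
  uCoord-below-s r s t eq = inU'-coords u-indep s (s≤d {r} {s} eq) _ (cf r s t)
    (proj₁ (proj₂ (proj₁ (corr r s t eq)))) (cfH r s t eq)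

  standard-coords : ∀ r s t → r + s + t + 1 ≡ d → ∃ λ α →
    ∀ i → i < n → cf (suc r) s t i ≈ α *F cf r s (suc t) i +F cf r (suc s) t i
  standard-coords r s t eq with std r s t eq
  ... | α , rel = α , v-coords-unique u-indep T-invertible _ _
        (≈ᴹ-trans (≈ᴹ-sym (cfH (suc r) s t (P.trans (shift-r r s t) eq))) expand)
    where
    open import Relation.Binary.Reasoning.Setoid ≈ᴹ-setoid
    expand : 𝓑 (suc r) s t ≈ᴹ lc n (λ i → α *F cf r s (suc t) i +F cf r (suc s) t i) v
    expand = begin
      𝓑 (suc r) s t ≈⟨ ≈ᴹ-sym (+ᴹ-identityʳ _) ⟩
      𝓑 (suc r) s t +ᴹ 0ᴹ ≈⟨ +ᴹ-congˡ (≈ᴹ-sym (-ᴹ‿inverseˡ _)) ⟩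
      𝓑 (suc r) s t +ᴹ ((-ᴹ 𝓑 r (suc s) t) +ᴹ 𝓑 r (suc s) t) ≈⟨ ≈ᴹ-sym (+ᴹ-assoc _ _ _) ⟩
      (𝓑 (suc r) s t +ᴹ (-ᴹ 𝓑 r (suc s) t)) +ᴹ 𝓑 r (suc s) t ≈⟨ +ᴹ-congʳ rel ⟩
      α *ₗ 𝓑 r s (suc t) +ᴹ 𝓑 r (suc s) t ≈⟨ +ᴹ-cong (*ₗ-congˡ (cfH r s (suc t) (P.trans (shift-t r s t) eq)))
                                                     (cfH r (suc s) t (P.trans (shift-s r s t) eq)) ⟩
      α *ₗ lc n (cf r s (suc t)) v +ᴹ lc n (cf r (suc s) t) v ≈⟨ +ᴹ-congʳ (lc-scale n α _ v) ⟩
      lc n (λ i → α *F cf r s (suc t) i) v +ᴹ lc n (cf r (suc s) t) v ≈⟨ ≈ᴹ-sym (lc-+ n _ _ v) ⟩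
      lc n (λ i → α *F cf r s (suc t) i +F cf r (suc s) t i) v ∎

  -- c_t(r,s,t) = 1, by induction on s: for s = 0 the normalisation gives 𝓑 = v_t, and
  -- the standard relation at index t reads 1 = α · 0 + c_t(r,s+1,t)
  cf-at-t : ∀ s r t → r + s + t ≡ d → cf r s t t ≈ 1#
  cf-at-t zero r t eq = trans (v-coords-unique u-indep T-invertible (cf r 0 t) (δ t)
      (≈ᴹ-trans (≈ᴹ-sym (cfH r 0 t eq)) (≈ᴹ-trans 𝓑≈vt (lc-δ n t v t<n))) t t<n) (δ-diag t)
    where
    t<n : t < n
    t<n = s≤s (t≤d {r} {0} eq)
    d∸t≡r : d ∸ t ≡ r
    d∸t≡r = P.trans (P.cong (_∸ t) (P.sym eq)) (P.trans (ℕP.m+n∸n≡m (r + 0) t) (ℕP.+-identityʳ r))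
    𝓑≈vt : 𝓑 r 0 t ≈ᴹ v t
    𝓑≈vt = P.subst (λ z → 𝓑 z 0 t ≈ᴹ v t) d∸t≡r (norm t (t≤d {r} {0} eq))
  cf-at-t (suc s) r t eq = begin
      cf r (suc s) t t ≈⟨ sym (+-identityˡ _) ⟩
      0# +F cf r (suc s) t t ≈⟨ +-congʳ (sym (trans (*-congˡ below) (zeroʳ α))) ⟩
      α *F cf r s (suc t) t +F cf r (suc s) t t ≈⟨ sym (coords t (s≤s (t≤d {r} {suc s} eq))) ⟩
      cf (suc r) s t t ≈⟨ cf-at-t s (suc r) t (P.trans (shift-r r s t) eq') ⟩
      1# ∎
    where
    open import Relation.Binary.Reasoning.Setoid setoid
    eq' : r + s + t + 1 ≡ d
    eq' = P.trans (P.sym (shift-s r s t)) eq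
    α : Carrier
    α = proj₁ (standard-coords r s t eq')
    coords : ∀ i → i < n → cf (suc r) s t i ≈ α *F cf r s (suc t) i +F cf r (suc s) t i
    coords = proj₂ (standard-coords r s t eq')
    below : cf r s (suc t) t ≈ 0#
    below = cf-below-t r s (suc t) (P.trans (shift-t r s t) eq') t ℕP.≤-refl

  -- the coefficients c_{t+1} … c_{d-r} solve T[t+1,d-r] x = -(T 0 t, …, T (s-1) t):
  -- rows p < s of T c vanish, and by uCoord-window they are exactly this system
  tail-coefficients : ∀ r s t → r + s + t ≡ d → ∀ N →
    IsInverse (size (suc t) (d ∸ r)) (sub T (suc t)) N →
    ∀ k → k < size (suc t) (d ∸ r) → cf r s t (suc t + k) ≈ -F ∑F s (λ l → N k l *F T l t)
  tail-coefficients r s t eq N inv k k<size =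
    solve-by-left-inverse s N (sub T (suc t)) (λ p → T p t) (λ j → cf r s t (suc t + j))
      (proj₂ (P.subst (λ z → IsInverse z (sub T (suc t)) N) size≡s inv))
      (λ p p<s → trans (sym (uCoord-window t s (cf r s t) t+s≤d (cf-below-t r s t eq) (cf-at-t s r t eq)
                          above-window p))
                       (uCoord-below-s r s t eq p p<s))
      k (P.subst (k <_) size≡s k<size)
    where
    d≡r+t+s : d ≡ r + (t + s)
    d≡r+t+s = P.trans (P.sym eq) (regroup-t+s r s t)
    d∸r≡t+s : d ∸ r ≡ t + s
    d∸r≡t+s = P.trans (P.cong (_∸ r) d≡r+t+s) (ℕP.m+n∸m≡n r (t + s))
    t+s≤d : t + s ≤ d
    t+s≤d = P.subst (t + s ≤_) (P.sym d≡r+t+s) (ℕP.m≤n+m (t + s) r)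
    size≡s : size (suc t) (d ∸ r) ≡ s
    size≡s = P.trans (P.cong (_∸ t) d∸r≡t+s) (ℕP.m+n∸m≡n t s)
    above-window : ∀ q → q ≤ d → t + s < q → cf r s t q ≈ 0#
    above-window q q≤d t+s<q = cf-above r s t eq q q≤d (P.subst (_< q) (P.sym d∸r≡t+s) t+s<q)

-- Proposition 6.4.
proposition6p4 : ∀ {c ℓ m ℓm : Level} (F : Field c ℓ)
    (M : Module (Field.commutativeRing F) m ℓm) →
    let open VS F M in
    (d : ℕ) (T : Matrix) (u : ℕ → Carrierᴹ) →
    UpperTriangular d T → VeryGood d T → IsBasis d u →
    (𝓑 : Arr) → IsConcreteBA d 𝓑 → IsStandard d 𝓑 → CorrespondsToB d T u 𝓑 →
    (∀ i → i ≤ d → 𝓑 (d ∸ i) 0 i ≈ᴹ vOf d T u i) →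
    (cf : ℕ → ℕ → ℕ → ℕ → Carrier) →
    (∀ r s t → r + s + t ≡ d → 𝓑 r s t ≈ᴹ lc (suc d) (cf r s t) (vOf d T u)) →
    ∀ r s t → r + s + t ≡ d →
    (cf r s t t ≈ 1#) ×
    (0 < s → ∀ N → IsInverse (size (suc t) (d ∸ r)) (sub T (suc t)) N →
    ∀ k → k < size (suc t) (d ∸ r) →
    cf r s t (suc t + k) ≈ -F ∑F s (λ l → N k l *F T l t))
proposition6p4 F M d T u UT VG BA 𝓑 _ std corr norm cf cfH r s t eq =
  cf-at-t s r t eq , λ _ → tail-coefficients r s t eq
  where open StandardArray F M d T u UT VG BA 𝓑 std corr norm cf cfH
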